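{- Let $n$ be a positive integer and $a,b$ indeterminates. Let $\tilde{\mathcal{G}}_n$ be the cycle with $n$ pendant edges equipped with the orientation in which each cycle edge is oriented $v_i\to v_{i+1}$ (indices mod $n$) and each pendant edge is oriented $v_i'\to v_i$, with nodes $\{v_1',\dots,v_n'\}$ and weights $w(\overrightarrow{v_i'v_i})=a$, $w(\overrightarrow{v_iv_{i+1}})=b$ for $i=1,\dots,n$. Let $\tilde F_n(a,b):=Z^{\mathrm{ori}}(\tilde{\mathcal{G}}_n)$ be the weighted sum of oriented rooted spanning forests. Then \[ \tilde F_n(a,b)=(a+b)^n-b^n. \]
   Context: The cycle with $n$ pendant edges has vertex set $\{v_1,\dots,v_n\}\cup\{v_1',\dots,v_n'\}$, cycle edges $e_i=v_iv_{i+1}$ ($i=1,\dots,n$, indices mod $n$) and pendant edges $e_i'=v_iv_i'$; the nodes are $v_1',\dots,v_n'$ and the internal vertices are $v_1,\dots,v_n$. A rooted spanning forest is a spanning subgraph with no cycles in which each connected component contains exactly one node. An oriented rooted spanning forest of the oriented graph is a rooted spanning forest in which, in each connected component, every edge is oriented (by the fixed orientation) outward, i.e. away from the node of that component. The weighted sum of oriented rooted spanning forests is $Z^{\mathrm{ori}}=\sum_{\mathcal{G}'}\prod_{\vec e\in E(\mathcal{G}')}w(\vec e)$, summed over all oriented rooted spanning forests $\mathcal{G}'$. -}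

module Defs where

open import Level using (Level)
open import Data.Nat using (ℕ; zero; suc; NonZero)
open import Data.Nat.DivMod using (_mod_)
open import Data.Fin using (Fin; toℕ)
open import Data.Bool using (Bool; true; false)
open import Data.Vec using (Vec; []; _∷_; lookup)
open import Data.List using (List; []; _∷_; foldr)
open import Data.List.Relation.Unary.Unique.Propositional using (Unique)
open import Data.List.Membership.Propositional using (_∈_)
open import Data.Product using (Σ; _×_; _,_)
open import Relation.Binary.PropositionalEquality using (_≡_)
open import Function.Bundles using (_⇔_)
open import Algebra.Bundles using (CommutativeRing)

data Vertex (n : ℕ) : Set where
  node  : Fin n → Vertex n
  inner : Fin n → Vertex n

data Edge (n : ℕ) : Set where
  pend : Fin n → Edge n
  cyc  : Fin n → Edge n

next : ∀ {n} .{{_ : NonZero n}} → Fin n → Fin n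
next {n} i = suc (toℕ i) mod n

tail : ∀ {n} .{{_ : NonZero n}} → Edge n → Vertex n
tail (pend i) = node i
tail (cyc i)  = inner i

head : ∀ {n} .{{_ : NonZero n}} → Edge n → Vertex n
head (pend i) = inner i
head (cyc i)  = inner (next i)

-- A spanning subgraph = a choice of edges:
-- (which pendant edges e_i' are present , which cycle edges e_i are present).
Subgraph : ℕ → Set
Subgraph n = Vec Bool n × Vec Bool n

Chosen : ∀ {n} → Subgraph n → Edge n → Set
Chosen (p , c) (pend i) = lookup p i ≡ true
Chosen (p , c) (cyc i)  = lookup c i ≡ true

module _ {n : ℕ} .{{_ : NonZero n}} where

  data Walk (S : Subgraph n) : Vertex n → Vertex n → Set where
    []  : ∀ {v} → Walk S v v
    fwd : ∀ {w} (e : Edge n) → Chosen S e → Walk S (head e) w → Walk S (tail e) w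
    bwd : ∀ {w} (e : Edge n) → Chosen S e → Walk S (tail e) w → Walk S (head e) w

  edgesOf : ∀ {S u v} → Walk S u v → List (Edge n)
  edgesOf []          = []
  edgesOf (fwd e _ t) = e ∷ edgesOf t
  edgesOf (bwd e _ t) = e ∷ edgesOf t

  IsTrail : ∀ {S u v} → Walk S u v → Set
  IsTrail t = Unique (edgesOf t)

  -- Acyclic: no closed trail with at least one edge (a cycle, possibly a loop
  -- or a pair of parallel edges).
  Acyclic : Subgraph n → Set
  Acyclic S = ∀ v (t : Walk S v v) → IsTrail t → edgesOf t ≡ []

  Connected : Subgraph n → Vertex n → Vertex n → Set
  Connected S u v = Walk S u v

  EachComponentOneNode : Subgraph n → Set
  EachComponentOneNode S =
    ∀ v → Σ (Fin n) λ i → Connected S (node i) v × (∀ j → Connected S (node j) v → j ≡ i)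

  IsRootedSpanningForest : Subgraph n → Set
  IsRootedSpanningForest S = Acyclic S × EachComponentOneNode S

  -- Every chosen edge e is oriented outward, i.e. away from the node of its
  -- component: the path from that node to head e ends by traversing e
  -- forwards (from tail e to head e).
  OrientedOutward : Subgraph n → Set
  OrientedOutward S = ∀ e → Chosen S e →
    Σ (Fin n) λ i → Σ (Walk S (node i) (tail e)) λ t → Unique (e ∷ edgesOf t)

  IsOrientedRootedSpanningForest : Subgraph n → Set
  IsOrientedRootedSpanningForest S = IsRootedSpanningForest S × OrientedOutward S

  EnumeratesORSF : List (Subgraph n) → Set
  EnumeratesORSF L = Unique L × (∀ S → (S ∈ L) ⇔ IsOrientedRootedSpanningForest S)

module Weights {c ℓ : Level} (R : CommutativeRing c ℓ) where
  open CommutativeRing R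

  wt : ∀ {m} → Vec Bool m → Carrier → Carrier
  wt []           x = 1#
  wt (true  ∷ bs) x = x * wt bs x
  wt (false ∷ bs) x = wt bs x

  weight : ∀ {n} → Carrier → Carrier → Subgraph n → Carrier
  weight a b (p , c) = wt p a * wt c b

  sumWeights : ∀ {n} → Carrier → Carrier → List (Subgraph n) → Carrier
  sumWeights a b = foldr (λ S acc → weight a b S + acc) 0#

  pow : Carrier → ℕ → Carrier
  pow x zero    = 1#
  pow x (suc k) = x * pow x k

module Submission where

-- In an oriented rooted spanning forest every internal vertex v_j has exactly one incoming edge,
-- the pendant edge e_j' or the cycle edge e_{j-1}; conversely such a choice of edges is an oriented
-- rooted spanning forest exactly when some cycle edge is missing.  Both directions rest on cut
-- parity: along a walk, the number of edges crossing a vertex set is odd iff the two ends lie on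
-- different sides.  The forests are thus indexed by the vectors c ≠ (1,…,1) of present cycle edges,
-- the forest of c has weight ∏_j (c_j ? b : a), and the sum over all c ≠ (1,…,1) is (a + b)^n − b^n.

open import Level using (Level)
open import Algebra.Bundles using (CommutativeRing)
open import Data.Bool using (Bool; true; false; not; _xor_; if_then_else_)
import Data.Bool as Bool
open import Data.Bool.Properties using (xor-same; xor-assoc; xor-comm; ¬-not)
open import Data.Empty using (⊥; ⊥-elim)
open import Data.Fin using (Fin; zero; suc; toℕ; fromℕ; inject₁; _≤_; _≟_)
open import Data.Fin.Induction using (<-weakInduction-startingFrom; >-weakInduction)
open import Data.Fin.Properties
  using (¬∀⟶∃¬; toℕ-injective; toℕ-fromℕ<; toℕ-fromℕ; toℕ-inject₁; toℕ<n; ≤fromℕ)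
open import Data.Fin.Relation.Unary.Top using (view; ‵fromℕ; ‵inject₁)
open import Data.List as List using (List; []; _∷_; foldr; _++_; [_])
open import Data.List.Membership.Propositional using (_∈_; _∉_)
open import Data.List.Membership.Propositional.Properties using (∈-map⁺; ∈-map⁻; ∈-++⁺ˡ; ∈-++⁺ʳ; ∈-++⁻)
open import Data.List.Membership.Propositional.Properties.WithK using (unique∧set⇒bag)
open import Data.List.Properties using (foldr-map; ++-conicalʳ)
open import Data.List.Relation.Binary.BagAndSetEquality using (∼bag⇒↭)
open import Data.List.Relation.Binary.Permutation.Propositional using (_↭_; ↭⇒↭ₛ′)
import Data.List.Relation.Binary.Permutation.Propositional.Properties as ↭
open import Data.List.Relation.Binary.Permutation.Setoid.Properties using (foldr-commMonoid)
open import Data.List.Relation.Unary.All using (All; []; _∷_)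
import Data.List.Relation.Unary.All as All
import Data.List.Relation.Unary.All.Properties as All
open import Data.List.Relation.Unary.AllPairs using ([]; _∷_)
import Data.List.Relation.Unary.AllPairs as AllPairs
open import Data.List.Relation.Unary.Any using (here; there)
open import Data.List.Relation.Unary.Unique.Propositional using (Unique)
import Data.List.Relation.Unary.Unique.Propositional.Properties as Unique
open import Data.Maybe as Maybe using (Maybe; just; nothing; _<∣>_; fromMaybe)
open import Data.Nat as ℕ using (ℕ; zero; suc; s≤s; z≤n; _∸_; NonZero)
open import Data.Nat.DivMod using (m<n⇒m%n≡m; n%n≡0)
open import Data.Product as Product using (Σ; _×_; _,_; proj₁; proj₂)
open import Data.Sum using (_⊎_; inj₁; inj₂)
open import Data.Vec as Vec using (Vec; []; _∷_; lookup; tabulate)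
open import Data.Vec.Properties
  using (∷-injectiveʳ; tabulate-∘; lookup∘tabulate; tabulate∘lookup; tabulate-cong)
open import Function using (_∘_; case_of_; id)
open import Function.Bundles using (_⇔_; mk⇔; Equivalence)
import Function.Properties.Equivalence as ⇔
open import Relation.Binary.Definitions using (DecidableEquality)
open import Relation.Binary.PropositionalEquality
  using (_≡_; _≢_; refl; sym; trans; cong; cong₂; subst; subst₂; module ≡-Reasoning)
open import Relation.Nullary using (yes; no; ¬_; does)
import Relation.Nullary.Decidable as Dec
open import Defs

-- The cycle order on Fin (suc n)

module _ {n : ℕ} where

  next-inject₁ : (k : Fin n) → next (inject₁ k) ≡ suc k
  next-inject₁ k = toℕ-injective (begin
    toℕ (next (inject₁ k))           ≡⟨ toℕ-fromℕ< _ ⟩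
    suc (toℕ (inject₁ k)) ℕ.% suc n  ≡⟨ cong (λ x → suc x ℕ.% suc n) (toℕ-inject₁ k) ⟩
    suc (toℕ k) ℕ.% suc n            ≡⟨ m<n⇒m%n≡m (s≤s (toℕ<n k)) ⟩
    suc (toℕ k)                      ∎)
    where open ≡-Reasoning

  next-fromℕ : next (fromℕ n) ≡ zero
  next-fromℕ = toℕ-injective (begin
    toℕ (next (fromℕ n))             ≡⟨ toℕ-fromℕ< _ ⟩
    suc (toℕ (fromℕ n)) ℕ.% suc n    ≡⟨ cong (λ x → suc x ℕ.% suc n) (toℕ-fromℕ n) ⟩
    suc n ℕ.% suc n                  ≡⟨ n%n≡0 (suc n) ⟩
    0                                ∎)
    where open ≡-Reasoning

  prev : Fin (suc n) → Fin (suc n)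
  prev zero    = fromℕ n
  prev (suc k) = inject₁ k

  next-prev : ∀ j → next (prev j) ≡ j
  next-prev zero    = next-fromℕ
  next-prev (suc k) = next-inject₁ k

  prev-next : ∀ k → prev (next k) ≡ k
  prev-next k with view k
  ... | ‵fromℕ      = cong prev next-fromℕ
  ... | ‵inject₁ k′ = cong prev (next-inject₁ k′)

  next-injective : ∀ {i j} → next i ≡ next j → i ≡ j
  next-injective {i} {j} eq = trans (sym (prev-next i)) (trans (cong prev eq) (prev-next j))

  next-invariant⇒universal : ∀ {ℓ} (P : Fin (suc n) → Set ℓ) →
    (∀ k → P k → P (next k)) → (∀ k → P (next k) → P k) → ∀ {i} → P i → ∀ j → P j
  next-invariant⇒universal P forward backward {i} Pi =
    >-weakInduction P Pfromℕ (λ k → backward (inject₁ k) ∘ subst P (sym (next-inject₁ k)))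
    where
    Pfromℕ : P (fromℕ n)
    Pfromℕ = <-weakInduction-startingFrom P Pi
      (λ k → subst P (next-inject₁ k) ∘ forward (inject₁ k)) (≤fromℕ i)

module _ {n : ℕ} .{{_ : NonZero n}} {S : Subgraph n} where

  edgesOf-chosen : ∀ {u v x} (t : Walk S u v) → x ∈ edgesOf t → Chosen S x
  edgesOf-chosen (fwd _ ch _) (here refl) = ch
  edgesOf-chosen (bwd _ ch _) (here refl) = ch
  edgesOf-chosen (fwd _ _ t)  (there x∈t) = edgesOf-chosen t x∈t
  edgesOf-chosen (bwd _ _ t)  (there x∈t) = edgesOf-chosen t x∈t

  snoc : ∀ {u v} {e : Edge n} → Walk S u (tail e) → Chosen S e → head e ≡ v → Walk S u v
  snoc []             ch refl = fwd _ ch []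
  snoc (fwd e′ ch′ t) ch eq   = fwd e′ ch′ (snoc t ch eq)
  snoc (bwd e′ ch′ t) ch eq   = bwd e′ ch′ (snoc t ch eq)

  edgesOf-snoc : ∀ {u v} {e : Edge n} (t : Walk S u (tail e)) (ch : Chosen S e) (eq : head e ≡ v) →
    edgesOf (snoc t ch eq) ≡ edgesOf t ++ [ e ]
  edgesOf-snoc []           ch refl = refl
  edgesOf-snoc (fwd e′ _ t) ch eq   = cong (e′ ∷_) (edgesOf-snoc t ch eq)
  edgesOf-snoc (bwd e′ _ t) ch eq   = cong (e′ ∷_) (edgesOf-snoc t ch eq)

  snoc-trail : ∀ {u v} {e : Edge n} {t : Walk S u (tail e)} (ch : Chosen S e) (eq : head e ≡ v) →
    IsTrail t → All (e ≢_) (edgesOf t) → IsTrail (snoc t ch eq)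
  snoc-trail {t = t} ch eq trail e∉t = subst Unique (sym (edgesOf-snoc t ch eq))
    (Unique.++⁺ trail ([] ∷ []) λ { (∈t , here refl) → All.All¬⇒¬Any e∉t ∈t })

  walk-from-node : ∀ {u w i k} (t : Walk S u w) → u ≡ node i → w ≡ inner k →
    Σ (Walk S (inner i) (inner k)) λ t′ → edgesOf t ≡ pend i ∷ edgesOf t′
  walk-from-node (fwd (pend _) _ t) refl refl = t , refl
  walk-from-node (fwd (cyc _) _ _)  ()   _
  walk-from-node (bwd (pend _) _ _) ()   _
  walk-from-node (bwd (cyc _) _ _)  ()   _
  walk-from-node []                 refl ()

-- Cut parity

parity : List Bool → Bool
parity = foldr _xor_ false

module _ {A : Set} (g : A → Bool) where

  parity-all-false : ∀ {xs} → (∀ {x} → x ∈ xs → g x ≡ false) → parity (List.map g xs) ≡ false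
  parity-all-false {[]}     _   = refl
  parity-all-false {x ∷ xs} gxs = cong₂ _xor_ (gxs (here refl)) (parity-all-false (gxs ∘ there))

  parity-single-true : ∀ {xs e} → Unique xs → e ∈ xs → g e ≡ true →
    (∀ {x} → x ∈ xs → g x ≡ true → x ≡ e) → parity (List.map g xs) ≡ true
  parity-single-true (x∉xs ∷ _) (here refl) ge only =
    cong₂ _xor_ ge (parity-all-false λ y∈xs → ¬-not λ gy → All.lookup x∉xs y∈xs (sym (only (there y∈xs) gy)))
  parity-single-true {x ∷ _} (x∉xs ∷ u) (there e∈xs) ge only with g x in gx
  ... | true  = ⊥-elim (All.lookup x∉xs (subst (_∈ _) (sym (only (here refl) gx)) e∈xs) refl)
  ... | false = parity-single-true u e∈xs ge (only ∘ there)

xor-cancel-middle : ∀ x y z → (x xor y) xor (y xor z) ≡ x xor z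
xor-cancel-middle x y z = begin
  (x xor y) xor (y xor z)  ≡⟨ xor-assoc x y (y xor z) ⟩
  x xor (y xor (y xor z))  ≡⟨ cong (x xor_) (xor-assoc y y z) ⟨
  x xor ((y xor y) xor z)  ≡⟨ cong (λ w → x xor (w xor z)) (xor-same y) ⟩
  x xor z                  ∎
  where open ≡-Reasoning

module _ {n : ℕ} .{{_ : NonZero n}} where

  crosses : (Vertex n → Bool) → Edge n → Bool
  crosses X e = X (tail e) xor X (head e)

  module _ {S : Subgraph n} (X : Vertex n → Bool) where

    walk-parity : ∀ {u v} (t : Walk S u v) → parity (List.map (crosses X) (edgesOf t)) ≡ X u xor X v
    walk-parity {u} []              = sym (xor-same (X u))
    walk-parity {v = v} (fwd e _ t) = trans (cong (crosses X e xor_) (walk-parity t))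
      (xor-cancel-middle (X (tail e)) (X (head e)) (X v))
    walk-parity {v = v} (bwd e _ t) = trans (cong₂ _xor_ (xor-comm (X (tail e)) (X (head e))) (walk-parity t))
      (xor-cancel-middle (X (head e)) (X (tail e)) (X v))

    uncrossed-walk-same-side : ∀ {u v} (t : Walk S u v) →
      (∀ {x} → x ∈ edgesOf t → crosses X x ≡ false) → X u ≡ X v
    uncrossed-walk-same-side {u} {v} t uncrossed =
      xor≡false⇒≡ (X u) (X v) (trans (sym (walk-parity t)) (parity-all-false (crosses X) uncrossed))
      where
      xor≡false⇒≡ : ∀ x y → x xor y ≡ false → x ≡ y
      xor≡false⇒≡ false _    eq = sym eq
      xor≡false⇒≡ true  true _  = refl

    lone-crossing-∉-closed-trail : ∀ {v e} (t : Walk S v v) → IsTrail t → crosses X e ≡ true →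
      (∀ {x} → x ∈ edgesOf t → crosses X x ≡ true → x ≡ e) → e ∉ edgesOf t
    lone-crossing-∉-closed-trail {v} t trail ce only e∈t
      with trans (sym (parity-single-true (crosses X) trail e∈t ce only)) (trans (walk-parity t) (xor-same (X v)))
    ... | ()

  _≟ᵥ_ : DecidableEquality (Vertex n)
  node i  ≟ᵥ node j  = Dec.map′ (cong node) (λ { refl → refl }) (i ≟ j)
  inner i ≟ᵥ inner j = Dec.map′ (cong inner) (λ { refl → refl }) (i ≟ j)
  node _  ≟ᵥ inner _ = no λ ()
  inner _ ≟ᵥ node _  = no λ ()

  at : Vertex n → Vertex n → Bool
  at v w = does (w ≟ᵥ v)

  crosses-at⇒incident : ∀ v e → crosses (at v) e ≡ true → tail e ≡ v ⊎ head e ≡ v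
  crosses-at⇒incident v e _  with tail e ≟ᵥ v | head e ≟ᵥ v
  crosses-at⇒incident v e _  | yes t≡v | _       = inj₁ t≡v
  crosses-at⇒incident v e _  | no _    | yes h≡v = inj₂ h≡v
  crosses-at⇒incident v e () | no _    | no _

  leaving-crosses-at : ∀ {v} e → tail e ≡ v → head e ≢ v → crosses (at v) e ≡ true
  leaving-crosses-at {v} e t≡v h≢v with tail e ≟ᵥ v | head e ≟ᵥ v
  ... | yes _  | no _    = refl
  ... | no t≢v | _       = ⊥-elim (t≢v t≡v)
  ... | yes _  | yes h≡v = ⊥-elim (h≢v h≡v)

  entering-crosses-at : ∀ {v} e → head e ≡ v → tail e ≢ v → crosses (at v) e ≡ true
  entering-crosses-at {v} e h≡v t≢v with tail e ≟ᵥ v | head e ≟ᵥ v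
  ... | no _    | yes _  = refl
  ... | _       | no h≢v = ⊥-elim (h≢v h≡v)
  ... | yes t≡v | yes _  = ⊥-elim (t≢v t≡v)

inner-injective : ∀ {n} {i j : Fin n} → inner i ≡ inner j → i ≡ j
inner-injective refl = refl

module _ {n : ℕ} where

  node-cut-crossing : ∀ {i} (x : Edge (suc n)) → crosses (at (node i)) x ≡ true → x ≡ pend i
  node-cut-crossing {i} (pend m) cx with crosses-at⇒incident (node i) (pend m) cx
  ... | inj₁ refl = refl
  node-cut-crossing {i} (cyc m)  cx with crosses-at⇒incident (node i) (cyc m) cx
  ... | inj₁ ()
  ... | inj₂ ()

  inner-cut-crossing : ∀ {k} (x : Edge (suc n)) → crosses (at (inner (next k))) x ≡ true →
    x ≡ pend (next k) ⊎ x ≡ cyc (next k) ⊎ x ≡ cyc k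
  inner-cut-crossing {k} (pend m) cx with crosses-at⇒incident (inner (next k)) (pend m) cx
  ... | inj₂ refl = inj₁ refl
  inner-cut-crossing {k} (cyc m)  cx with crosses-at⇒incident (inner (next k)) (cyc m) cx
  ... | inj₁ refl          = inj₂ (inj₁ refl)
  ... | inj₂ next-m≡next-k = inj₂ (inj₂ (cong cyc (next-injective (inner-injective next-m≡next-k))))

-- Acyclicity

module _ {n : ℕ} {p c : Vec Bool (suc n)} {v : Vertex (suc n)}
         (t : Walk (p , c) v v) (trail : IsTrail t) where

  pendant-∉-closed-trail : ∀ i → pend i ∉ edgesOf t
  pendant-∉-closed-trail i = lone-crossing-∉-closed-trail (at (node i)) t trail
    (leaving-crosses-at (pend i) refl λ ()) (λ {x} _ → node-cut-crossing x)

  cycle-edge-∉-next : ∀ k → cyc k ∉ edgesOf t → cyc (next k) ∉ edgesOf t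
  cycle-edge-∉-next k k∉t with next k ≟ k
  ... | yes next≡k = subst (λ j → cyc j ∉ edgesOf t) (sym next≡k) k∉t
  ... | no  next≢k = lone-crossing-∉-closed-trail (at (inner (next k))) t trail
    (leaving-crosses-at (cyc (next k)) refl (next≢k ∘ next-injective ∘ inner-injective)) only
    where
    only : ∀ {x} → x ∈ edgesOf t → crosses (at (inner (next k))) x ≡ true → x ≡ cyc (next k)
    only {x} x∈t cx with inner-cut-crossing x cx
    ... | inj₁ refl          = ⊥-elim (pendant-∉-closed-trail (next k) x∈t)
    ... | inj₂ (inj₁ x≡next) = x≡next
    ... | inj₂ (inj₂ refl)   = ⊥-elim (k∉t x∈t)

  cycle-edge-∉-prev : ∀ k → cyc (next k) ∉ edgesOf t → cyc k ∉ edgesOf t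
  cycle-edge-∉-prev k next∉t with next k ≟ k
  ... | yes next≡k = subst (λ j → cyc j ∉ edgesOf t) next≡k next∉t
  ... | no  next≢k = lone-crossing-∉-closed-trail (at (inner (next k))) t trail
    (entering-crosses-at (cyc k) refl (next≢k ∘ sym ∘ inner-injective)) only
    where
    only : ∀ {x} → x ∈ edgesOf t → crosses (at (inner (next k))) x ≡ true → x ≡ cyc k
    only {x} x∈t cx with inner-cut-crossing x cx
    ... | inj₁ refl        = ⊥-elim (pendant-∉-closed-trail (next k) x∈t)
    ... | inj₂ (inj₁ refl) = ⊥-elim (next∉t x∈t)
    ... | inj₂ (inj₂ x≡k)  = x≡k

SomeFalse : ∀ {m} → Vec Bool m → Set
SomeFalse {m} v = Σ (Fin m) λ k → lookup v k ≡ false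

acyclic-if-cycle-broken : ∀ {n} {p c : Vec Bool (suc n)} → SomeFalse c → Acyclic (p , c)
acyclic-if-cycle-broken {n} (k₀ , ck₀) v t trail = no-members (edgesOf t) ∉t
  where
  cyc∉t : ∀ k → cyc k ∉ edgesOf t
  cyc∉t = next-invariant⇒universal (λ k → cyc k ∉ edgesOf t)
    (cycle-edge-∉-next t trail) (cycle-edge-∉-prev t trail)
    λ k₀∈t → case trans (sym ck₀) (edgesOf-chosen t k₀∈t) of λ ()
  ∉t : ∀ x → x ∉ edgesOf t
  ∉t (pend i) = pendant-∉-closed-trail t trail i
  ∉t (cyc k)  = cyc∉t k
  no-members : ∀ (xs : List (Edge (suc n))) → (∀ x → x ∉ xs) → xs ≡ []
  no-members []      _   = refl
  no-members (x ∷ _) ∉xs = ⊥-elim (∉xs x (here refl))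

-- Roots

lastTrueUpTo : ∀ {m} → Vec Bool m → Fin m → Maybe (Fin m)
lastTrueUpTo (b ∷ _) zero    = if b then just zero else nothing
lastTrueUpTo (b ∷ v) (suc j) = Maybe.map suc (lastTrueUpTo v j) <∣> lastTrueUpTo (b ∷ v) zero

lastTrueUpTo-true : ∀ {m} (v : Vec Bool m) {j} → lookup v j ≡ true → lastTrueUpTo v j ≡ just j
lastTrueUpTo-true (b ∷ _) {zero}  refl = refl
lastTrueUpTo-true (b ∷ v) {suc j} vj   rewrite lastTrueUpTo-true v vj = refl

lastTrueUpTo-≤ : ∀ {m} (v : Vec Bool m) j {i} → lastTrueUpTo v j ≡ just i → i ≤ j
lastTrueUpTo-≤ (true ∷ _) zero    refl = z≤n
lastTrueUpTo-≤ (b ∷ v)    (suc j) eq   with lastTrueUpTo v j in eqⱼ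
lastTrueUpTo-≤ (b ∷ v)    (suc j) refl | just _  = s≤s (lastTrueUpTo-≤ v j eqⱼ)
lastTrueUpTo-≤ (true ∷ v) (suc j) refl | nothing = z≤n

lastTrueUpTo-just : ∀ {m} (v : Vec Bool m) {i j} → lookup v i ≡ true → i ≤ j →
  Σ (Fin m) λ k → lastTrueUpTo v j ≡ just k
lastTrueUpTo-just (true ∷ _) {zero}  {zero}  _  _ = zero , refl
lastTrueUpTo-just (true ∷ v) {zero}  {suc j} _  _ with lastTrueUpTo v j
... | just k  = suc k , refl
... | nothing = zero , refl
lastTrueUpTo-just (b ∷ v)    {suc i} {suc j} vi (s≤s i≤j) with lastTrueUpTo-just v vi i≤j
... | k , eq = suc k , cong (λ l → Maybe.map suc l <∣> lastTrueUpTo (b ∷ v) zero) eq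

lastTrueUpTo-false-zero : ∀ {m} (v : Vec Bool (suc m)) → lookup v zero ≡ false → lastTrueUpTo v zero ≡ nothing
lastTrueUpTo-false-zero (false ∷ _) refl = refl

lastTrueUpTo-false-suc : ∀ {m} (v : Vec Bool (suc m)) {k} → lookup v (suc k) ≡ false →
  lastTrueUpTo v (suc k) ≡ lastTrueUpTo v (inject₁ k)
lastTrueUpTo-false-suc (b ∷ false ∷ _) {zero}  refl = refl
lastTrueUpTo-false-suc (b ∷ v)         {suc k} vk   =
  cong (λ l → Maybe.map suc l <∣> lastTrueUpTo (b ∷ v) zero) (lastTrueUpTo-false-suc v vk)

-- root j indexes the nearest chosen pendant edge going backwards round the cycle from v_j: the
-- last i ≤ j with p_i, or else the last one overall, r.  position j is the index of j on the cycle unrolled so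
-- that this root precedes it, and dist j is the number of cycle edges from the root to v_j.
module Roots {n : ℕ} (p : Vec Bool (suc n)) {r : Fin (suc n)} (last : lastTrueUpTo p (fromℕ n) ≡ just r) where

  open import Data.Nat using (_+_)
  open import Data.Nat.Properties using (≤-trans; m≤m+n; m≤n+m; <⇒≤; +-identityʳ; +-∸-assoc)

  root : Fin (suc n) → Fin (suc n)
  root j = fromMaybe r (lastTrueUpTo p j)

  lap : Maybe (Fin (suc n)) → ℕ
  lap (just _) = 0
  lap nothing  = suc n

  position : Fin (suc n) → ℕ
  position j = toℕ j + lap (lastTrueUpTo p j)

  dist : Fin (suc n) → ℕ
  dist j = position j ∸ toℕ (root j)

  root-true : ∀ {j} → lookup p j ≡ true → root j ≡ j
  root-true pj = cong (fromMaybe r) (lastTrueUpTo-true p pj)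

  root-false : ∀ {j} → lookup p j ≡ false → root j ≡ root (prev j)
  root-false {zero}  pj = trans (cong (fromMaybe r) (lastTrueUpTo-false-zero p pj)) (cong (fromMaybe r) (sym last))
  root-false {suc k} pj = cong (fromMaybe r) (lastTrueUpTo-false-suc p pj)

  root≤position : ∀ j → toℕ (root j) ℕ.≤ position j
  root≤position j with lastTrueUpTo p j in eq
  ... | just i  = ≤-trans (lastTrueUpTo-≤ p j eq) (m≤m+n (toℕ j) 0)
  ... | nothing = ≤-trans (<⇒≤ (toℕ<n r)) (m≤n+m (suc n) (toℕ j))

  position-false : ∀ {j} → lookup p j ≡ false → position j ≡ suc (position (prev j))
  position-false {zero} pj = begin
    lap (lastTrueUpTo p zero)  ≡⟨ cong lap (lastTrueUpTo-false-zero p pj) ⟩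
    suc n                      ≡⟨ cong suc (+-identityʳ n) ⟨
    suc (n + 0)                ≡⟨ cong suc (cong₂ _+_ (toℕ-fromℕ n) (cong lap last)) ⟨
    suc (position (fromℕ n))   ∎
    where open ≡-Reasoning
  position-false {suc k} pj =
    cong₂ (λ x l → suc (x + lap l)) (sym (toℕ-inject₁ k)) (lastTrueUpTo-false-suc p pj)

  dist-false : ∀ {j} → lookup p j ≡ false → dist j ≡ suc (dist (prev j))
  dist-false {j} pj = begin
    position j ∸ toℕ (root j)                      ≡⟨ cong₂ _∸_ (position-false pj) (cong toℕ (root-false pj)) ⟩
    suc (position (prev j)) ∸ toℕ (root (prev j))  ≡⟨ +-∸-assoc 1 (root≤position (prev j)) ⟩
    suc (dist (prev j))                            ∎
    where open ≡-Reasoning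

-- Characterisation of the oriented rooted spanning forests

ExactlyOneInEdge : ∀ {n} → Vec Bool (suc n) → Vec Bool (suc n) → Set
ExactlyOneInEdge p c = ∀ j → lookup p j ≡ not (lookup c (prev j))

module Soundness {n : ℕ} {p c : Vec Bool (suc n)} (one-in : ExactlyOneInEdge p c)
                 {r : Fin (suc n)} (last : lastTrueUpTo p (fromℕ n) ≡ just r) where

  open Roots p last
  open import Data.Nat.Properties using (≤-refl; m≤n⇒m≤1+n; 1+n≰n; suc-injective)

  c-prev-true : ∀ {j} → lookup p j ≡ false → lookup c (prev j) ≡ true
  c-prev-true {j} pj with lookup c (prev j) | one-in j
  ... | true  | _  = refl
  ... | false | eq = case trans (sym pj) eq of λ ()

  p-next-false : ∀ {k} → lookup c k ≡ true → lookup p (next k) ≡ false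
  p-next-false {k} ck = trans (one-in (next k)) (trans (cong (not ∘ lookup c) (prev-next k)) (cong not ck))

  rank : Edge (suc n) → ℕ
  rank (pend _) = 0
  rank (cyc k)  = suc (dist k)

  record TrailFromNode (j : Fin (suc n)) : Set where
    field
      {origin} : Fin (suc n)
      trail    : Walk (p , c) (node origin) (inner j)
      unique   : IsTrail trail
      rank-≤   : All (λ e → rank e ℕ.≤ dist j) (edgesOf trail)

    cyc-∉ : All (cyc j ≢_) (edgesOf trail)
    cyc-∉ = All.map (λ r≤d eq → 1+n≰n (subst (λ e → rank e ℕ.≤ dist j) (sym eq) r≤d)) rank-≤

  extend : ∀ {j} → lookup p j ≡ false → TrailFromNode (prev j) → TrailFromNode j
  extend {j} pj T = record
    { trail  = snoc trail (c-prev-true pj) (cong inner (next-prev j))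
    ; unique = snoc-trail _ _ unique cyc-∉
    ; rank-≤ = subst₂ (λ d es → All (λ e → rank e ℕ.≤ d) es) (sym (dist-false pj)) (sym (edgesOf-snoc trail _ _))
                 (All.++⁺ (All.map m≤n⇒m≤1+n rank-≤) (≤-refl ∷ []))
    }
    where open TrailFromNode T

  trailFromNode : ∀ j → TrailFromNode j
  trailFromNode j = go (dist j) j refl
    where
    go : ∀ d j → dist j ≡ d → TrailFromNode j
    go d j dⱼ with lookup p j in pj
    ... | true  = record { trail = fwd (pend j) pj [] ; unique = [] ∷ [] ; rank-≤ = z≤n ∷ [] }
    ... | false with d
    ...   | zero   = case trans (sym dⱼ) (dist-false pj) of λ ()
    ...   | suc d′ = extend pj (go d′ (prev j) (suc-injective (trans (sym (dist-false pj)) dⱼ)))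

  rootᵥ : Vertex (suc n) → Fin (suc n)
  rootᵥ (node i)  = i
  rootᵥ (inner j) = root j

  chosen-edge-preserves-root : ∀ e → Chosen (p , c) e → rootᵥ (tail e) ≡ rootᵥ (head e)
  chosen-edge-preserves-root (pend i) pi = sym (root-true pi)
  chosen-edge-preserves-root (cyc k)  ck = trans (cong root (sym (prev-next k))) (sym (root-false (p-next-false ck)))

  walk-preserves-root : ∀ {u v} → Walk (p , c) u v → rootᵥ u ≡ rootᵥ v
  walk-preserves-root []           = refl
  walk-preserves-root (fwd e ch t) = trans (chosen-edge-preserves-root e ch) (walk-preserves-root t)
  walk-preserves-root (bwd e ch t) = trans (sym (chosen-edge-preserves-root e ch)) (walk-preserves-root t)

  each-component-one-node : EachComponentOneNode (p , c)
  each-component-one-node (node i)  = i , [] , λ _ w → walk-preserves-root w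
  each-component-one-node (inner j) =
    origin , trail , λ _ w → trans (walk-preserves-root w) (sym (walk-preserves-root trail))
    where open TrailFromNode (trailFromNode j)

  oriented-outward : OrientedOutward (p , c)
  oriented-outward (pend i) _ = i , [] , [] ∷ []
  oriented-outward (cyc k)  _ = origin , trail , cyc-∉ ∷ unique
    where open TrailFromNode (trailFromNode k)

isNode : ∀ {n} → Vertex n → Bool
isNode (node _)  = true
isNode (inner _) = false

module Completeness {n : ℕ} {p c : Vec Bool (suc n)} (orsf : IsOrientedRootedSpanningForest (p , c)) where

  private
    acyclic    = proj₁ (proj₁ orsf)
    components = proj₂ (proj₁ orsf)
    oriented   = proj₂ orsf

  -- The node of v_{k+1}'s component is v_{k+1}' itself, so the oriented trail to v_k starts with
  -- e_{k+1}', and the rest of it, closed by e_k, is a cycle.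
  ¬two-in-edges : ∀ k → lookup c k ≡ true → lookup p (next k) ≡ true → ⊥
  ¬two-in-edges k ck pj with oriented (cyc k) ck
  ... | i , t , cyc∉t ∷ trail with walk-from-node t refl refl
  ...   | t′ , t≡ = case ++-conicalʳ (edgesOf t′) _ (trans (sym (edgesOf-snoc t′ ck _)) (acyclic (inner i) cycle cycle-trail)) of λ ()
    where
    i≡next : i ≡ next k
    i≡next = let _ , _ , only = components (inner (next k))
             in trans (only i (snoc t ck refl)) (sym (only (next k) (fwd (pend (next k)) pj [])))
    cycle : Walk (p , c) (inner i) (inner i)
    cycle = snoc t′ ck (cong inner (sym i≡next))
    cycle-trail : IsTrail cycle
    cycle-trail = snoc-trail ck _ (AllPairs.tail (subst Unique t≡ trail)) (All.tail (subst (All _) t≡ cyc∉t))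

  unreachable-without-in-edge : ∀ {k i} → lookup c k ≡ false → lookup p (next k) ≡ false →
    (t : Walk (p , c) (node i) (inner (next k))) → cyc (next k) ∉ edgesOf t → ⊥
  unreachable-without-in-edge {k} ck pj t next∉t = case trans
    (uncrossed-walk-same-side (at (inner (next k))) t uncrossed) (Dec.dec-true (inner (next k) ≟ᵥ inner (next k)) refl)
    of λ ()
    where
    uncrossed : ∀ {x} → x ∈ edgesOf t → crosses (at (inner (next k))) x ≡ false
    uncrossed {x} x∈t = ¬-not λ cx → case inner-cut-crossing x cx of λ where
      (inj₁ refl)        → case trans (sym pj) (edgesOf-chosen t x∈t) of λ ()
      (inj₂ (inj₁ refl)) → next∉t x∈t
      (inj₂ (inj₂ refl)) → case trans (sym ck) (edgesOf-chosen t x∈t) of λ ()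

  -- With e_k and e_{k+1}' absent only e_{k+1} crosses the cut {v_{k+1}}, yet some walk from a node
  -- to v_{k+1} avoids it: the component walk if e_{k+1} is absent, the oriented trail to its tail if not.
  ¬no-in-edge : ∀ k → lookup c k ≡ false → lookup p (next k) ≡ false → ⊥
  ¬no-in-edge k ck pj with lookup c (next k) in cj
  ... | false = let _ , t , _ = components (inner (next k))
                in unreachable-without-in-edge ck pj t λ ∈t → case trans (sym cj) (edgesOf-chosen t ∈t) of λ ()
  ... | true  = let _ , t , trail = oriented (cyc (next k)) cj
                in unreachable-without-in-edge ck pj t (All.All¬⇒¬Any (AllPairs.head trail))

  exactly-one-in-edge : ExactlyOneInEdge p c
  exactly-one-in-edge j = trans (cong (lookup p) (sym (next-prev j))) (p-next≡not-c (prev j))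
    where
    p-next≡not-c : ∀ k → lookup p (next k) ≡ not (lookup c k)
    p-next≡not-c k with lookup c k in ck | lookup p (next k) in pk
    ... | true  | false = refl
    ... | false | true  = refl
    ... | true  | true  = ⊥-elim (¬two-in-edges k ck pk)
    ... | false | false = ⊥-elim (¬no-in-edge k ck pk)

  -- With every cycle edge present no pendant edge is, so no chosen edge crosses the cut of nodes.
  cycle-broken : SomeFalse c
  cycle-broken = Product.map₂ ¬-not (¬∀⟶∃¬ _ (λ k → lookup c k ≡ true) (λ k → lookup c k Bool.≟ true) ¬all-chosen)
    where
    ¬all-chosen : ¬ (∀ k → lookup c k ≡ true)
    ¬all-chosen all-chosen = case uncrossed-walk-same-side isNode t uncrossed of λ ()
      where
      t = proj₁ (proj₂ (components (inner zero)))
      uncrossed : ∀ {x} → x ∈ edgesOf t → crosses isNode x ≡ false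
      uncrossed {pend m} x∈t = case trans (sym (edgesOf-chosen t x∈t))
        (trans (exactly-one-in-edge m) (cong not (all-chosen (prev m)))) of λ ()
      uncrossed {cyc _}  _   = refl

orsf⇔ : ∀ {n} {p c : Vec Bool (suc n)} →
  IsOrientedRootedSpanningForest (p , c) ⇔ (ExactlyOneInEdge p c × SomeFalse c)
orsf⇔ {p = p} {c} = mk⇔ (λ orsf → exactly-one-in-edge orsf , cycle-broken orsf) sound
  where
  open Completeness
  sound : ExactlyOneInEdge p c × SomeFalse c → IsOrientedRootedSpanningForest (p , c)
  sound (one-in , k₀ , ck₀) = (acyclic-if-cycle-broken (k₀ , ck₀) , each-component-one-node) , oriented-outward
    where
    p-next-k₀ : lookup p (next k₀) ≡ true
    p-next-k₀ = trans (one-in (next k₀)) (trans (cong (not ∘ lookup c) (prev-next k₀)) (cong not ck₀))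
    open Soundness {p = p} {c} one-in (proj₂ (lastTrueUpTo-just p p-next-k₀ (≤fromℕ (next k₀))))

-- Enumeration

allVecs : ∀ m → List (Vec Bool m)
allVecs zero    = [ [] ]
allVecs (suc m) = List.map (false ∷_) (allVecs m) ++ List.map (true ∷_) (allVecs m)

vecsWithFalse : ∀ m → List (Vec Bool m)
vecsWithFalse zero    = []
vecsWithFalse (suc m) = List.map (false ∷_) (allVecs m) ++ List.map (true ∷_) (vecsWithFalse m)

∈-allVecs : ∀ {m} (v : Vec Bool m) → v ∈ allVecs m
∈-allVecs []          = here refl
∈-allVecs (false ∷ v) = ∈-++⁺ˡ (∈-map⁺ (false ∷_) (∈-allVecs v))
∈-allVecs (true ∷ v)  = ∈-++⁺ʳ (List.map (false ∷_) (allVecs _)) (∈-map⁺ (true ∷_) (∈-allVecs v))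

∈-vecsWithFalse⇔ : ∀ {m} {v : Vec Bool m} → v ∈ vecsWithFalse m ⇔ SomeFalse v
∈-vecsWithFalse⇔ = mk⇔ to from
  where
  to : ∀ {m} {v : Vec Bool m} → v ∈ vecsWithFalse m → SomeFalse v
  to {suc m} v∈ with ∈-++⁻ (List.map (false ∷_) (allVecs m)) v∈
  ... | inj₁ ∈false with ∈-map⁻ (false ∷_) ∈false
  ...   | _ , _ , refl = zero , refl
  to {suc m} v∈ | inj₂ ∈true with ∈-map⁻ (true ∷_) ∈true
  ...   | _ , w∈ , refl = Product.map suc id (to w∈)
  from : ∀ {m} {v : Vec Bool m} → SomeFalse v → v ∈ vecsWithFalse m
  from {v = false ∷ v} _            = ∈-++⁺ˡ (∈-map⁺ (false ∷_) (∈-allVecs v))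
  from {v = true ∷ v}  (suc k , vk) = ∈-++⁺ʳ (List.map (false ∷_) (allVecs _)) (∈-map⁺ (true ∷_) (from (k , vk)))

unique-false∷-++-true∷ : ∀ {m} {xs ys : List (Vec Bool m)} → Unique xs → Unique ys →
  Unique (List.map (false ∷_) xs ++ List.map (true ∷_) ys)
unique-false∷-++-true∷ uxs uys =
  Unique.++⁺ (Unique.map⁺ ∷-injectiveʳ uxs) (Unique.map⁺ ∷-injectiveʳ uys) λ (∈f , ∈t) →
    case ∈-map⁻ (false ∷_) ∈f , ∈-map⁻ (true ∷_) ∈t of λ { ((_ , _ , refl) , (_ , _ , ())) }

allVecs-unique : ∀ m → Unique (allVecs m)
allVecs-unique zero    = [] ∷ []
allVecs-unique (suc m) = unique-false∷-++-true∷ (allVecs-unique m) (allVecs-unique m)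

vecsWithFalse-unique : ∀ m → Unique (vecsWithFalse m)
vecsWithFalse-unique zero    = []
vecsWithFalse-unique (suc m) = unique-false∷-++-true∷ (allVecs-unique m) (vecsWithFalse-unique m)

module _ {n : ℕ} where

  withPendants : Vec Bool (suc n) → Subgraph (suc n)
  withPendants c = tabulate (λ j → not (lookup c (prev j))) , c

  forests : List (Subgraph (suc n))
  forests = List.map withPendants (vecsWithFalse (suc n))

  ∈-forests⇔ : ∀ {S} → S ∈ forests ⇔ IsOrientedRootedSpanningForest S
  ∈-forests⇔ {p , c} = mk⇔ to from
    where
    to : (p , c) ∈ forests → IsOrientedRootedSpanningForest (p , c)
    to S∈ with ∈-map⁻ withPendants S∈
    ... | c , c∈ , refl = Equivalence.from orsf⇔ (lookup∘tabulate _ , Equivalence.to ∈-vecsWithFalse⇔ c∈)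
    from : IsOrientedRootedSpanningForest (p , c) → (p , c) ∈ forests
    from orsf with Equivalence.to orsf⇔ orsf
    ... | one-in , cycle-broken = subst (_∈ forests) (cong (_, c) (trans (sym (tabulate-cong one-in)) (tabulate∘lookup p)))
                                    (∈-map⁺ withPendants (Equivalence.from ∈-vecsWithFalse⇔ cycle-broken))

  forests-enumerate : EnumeratesORSF forests
  forests-enumerate = Unique.map⁺ (cong proj₂) (vecsWithFalse-unique (suc n)) , λ _ → ∈-forests⇔

enumerations-↭ : ∀ {n} .{{_ : NonZero n}} {L L′ : List (Subgraph n)} →
  EnumeratesORSF L → EnumeratesORSF L′ → L ↭ L′
enumerations-↭ (unique , ∈L⇔) (unique′ , ∈L′⇔) =
  ∼bag⇒↭ (unique∧set⇒bag unique unique′ λ {S} → ⇔.trans (∈L⇔ S) (⇔.sym (∈L′⇔ S)))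

-- Weights

module WeightedSums {c ℓ : Level} (R : CommutativeRing c ℓ) (a b : CommutativeRing.Carrier R) where

  open CommutativeRing R hiding (zero) renaming (refl to ≈-refl; sym to ≈-sym; trans to ≈-trans)
  open Weights R
  open import Relation.Binary.Reasoning.Setoid setoid
  open import Algebra.Properties.Ring ring using (x[y-z]≈xy-xz)
  open import Algebra.Properties.CommutativeSemigroup *-commutativeSemigroup using (x∙yz≈y∙xz)

  sumWeights-↭ : ∀ {m} {L L′ : List (Subgraph m)} → L ↭ L′ → sumWeights a b L ≈ sumWeights a b L′
  sumWeights-↭ {L = L} {L′} L↭L′ = begin
    sumWeights a b L                         ≡⟨ foldr-map _+_ (weight a b) 0# L ⟨
    foldr _+_ 0# (List.map (weight a b) L)   ≈⟨ foldr-commMonoid setoid +-isCommutativeMonoid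
                                                  (↭⇒↭ₛ′ isEquivalence (↭.map⁺ (weight a b) L↭L′)) ⟩
    foldr _+_ 0# (List.map (weight a b) L′)  ≡⟨ foldr-map _+_ (weight a b) 0# L′ ⟩
    sumWeights a b L′                        ∎

  wt-swap : ∀ {m} x y (v : Vec Bool m) z → wt (x ∷ y ∷ v) z ≈ wt (y ∷ x ∷ v) z
  wt-swap true  true  _ _ = ≈-refl
  wt-swap true  false _ _ = ≈-refl
  wt-swap false true  _ _ = ≈-refl
  wt-swap false false _ _ = ≈-refl

  wt-∷-cong : ∀ {m} x {u v : Vec Bool m} z → wt u z ≈ wt v z → wt (x ∷ u) z ≈ wt (x ∷ v) z
  wt-∷-cong true  _ = *-congˡ
  wt-∷-cong false _ = id

  -- At length 2 + n, tabulate (g ∘ prev) reduces to g (prev zero) ∷ g zero ∷ xs, where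
  -- g (prev zero) ∷ xs is tabulate (g ∘ suc ∘ prev) at length 1 + n.
  wt-rotate : ∀ {n} (g : Fin (suc n) → Bool) z → wt (tabulate (g ∘ prev)) z ≈ wt (tabulate g) z
  wt-rotate {zero}  g z = ≈-refl
  wt-rotate {suc n} g z =
    ≈-trans (wt-swap (g (prev zero)) (g zero) _ z) (wt-∷-cong (g zero) z (wt-rotate (g ∘ suc) z))

  forestWeight : ∀ {m} → Vec Bool m → Carrier
  forestWeight c = wt (Vec.map not c) a * wt c b

  weight-withPendants : ∀ {n} (c : Vec Bool (suc n)) → weight a b (withPendants c) ≈ forestWeight c
  weight-withPendants c = *-congʳ (begin
    wt (tabulate ((not ∘ lookup c) ∘ prev)) a  ≈⟨ wt-rotate (not ∘ lookup c) a ⟩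
    wt (tabulate (not ∘ lookup c)) a           ≡⟨ cong (λ v → wt v a) (tabulate-∘ not (lookup c)) ⟩
    wt (Vec.map not (tabulate (lookup c))) a   ≡⟨ cong (λ v → wt (Vec.map not v) a) (tabulate∘lookup c) ⟩
    wt (Vec.map not c) a                       ∎)

  forestWeight-false : ∀ {m} (v : Vec Bool m) → forestWeight (false ∷ v) ≈ a * forestWeight v
  forestWeight-false _ = *-assoc _ _ _

  forestWeight-true : ∀ {m} (v : Vec Bool m) → forestWeight (true ∷ v) ≈ b * forestWeight v
  forestWeight-true _ = x∙yz≈y∙xz _ b _

  sumForestWeights : ∀ {m} → List (Vec Bool m) → Carrier
  sumForestWeights = foldr (λ v → forestWeight v +_) 0#

  sumWeights-forests : ∀ {n} (cs : List (Vec Bool (suc n))) →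
    sumWeights a b (List.map withPendants cs) ≈ sumForestWeights cs
  sumWeights-forests []       = ≈-refl
  sumWeights-forests (c ∷ cs) = +-cong (weight-withPendants c) (sumWeights-forests cs)

  sumForestWeights-++ : ∀ {m} (xs ys : List (Vec Bool m)) →
    sumForestWeights (xs ++ ys) ≈ sumForestWeights xs + sumForestWeights ys
  sumForestWeights-++ []       _  = ≈-sym (+-identityˡ _)
  sumForestWeights-++ (x ∷ xs) ys = ≈-trans (+-congˡ (sumForestWeights-++ xs ys)) (≈-sym (+-assoc _ _ _))

  sumForestWeights-map-∷ : ∀ {m} {x k} → (∀ (v : Vec Bool m) → forestWeight (x ∷ v) ≈ k * forestWeight v) →
    ∀ vs → sumForestWeights (List.map (x ∷_) vs) ≈ k * sumForestWeights vs
  sumForestWeights-map-∷ {k = k} _      []       = ≈-sym (zeroʳ k)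
  sumForestWeights-map-∷ {k = k} weight-∷ (v ∷ vs) =
    ≈-trans (+-cong (weight-∷ v) (sumForestWeights-map-∷ weight-∷ vs)) (≈-sym (distribˡ k _ _))

  sumForestWeights-split : ∀ {m} (xs ys : List (Vec Bool m)) →
    sumForestWeights (List.map (false ∷_) xs ++ List.map (true ∷_) ys) ≈
    a * sumForestWeights xs + b * sumForestWeights ys
  sumForestWeights-split xs ys = ≈-trans (sumForestWeights-++ (List.map (false ∷_) xs) _)
    (+-cong (sumForestWeights-map-∷ forestWeight-false xs) (sumForestWeights-map-∷ forestWeight-true ys))

  sumForestWeights-allVecs : ∀ m → sumForestWeights (allVecs m) ≈ pow (a + b) m
  sumForestWeights-allVecs zero    = ≈-trans (+-identityʳ _) (*-identityˡ 1#)
  sumForestWeights-allVecs (suc m) = begin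
    sumForestWeights (allVecs (suc m))  ≈⟨ sumForestWeights-split (allVecs m) (allVecs m) ⟩
    a * X + b * X                       ≈⟨ distribʳ X a b ⟨
    (a + b) * X                         ≈⟨ *-congˡ (sumForestWeights-allVecs m) ⟩
    pow (a + b) (suc m)                 ∎
    where X = sumForestWeights (allVecs m)

  sumForestWeights-vecsWithFalse : ∀ m → sumForestWeights (vecsWithFalse m) ≈ pow (a + b) m - pow b m
  sumForestWeights-vecsWithFalse zero    = ≈-sym (-‿inverseʳ 1#)
  sumForestWeights-vecsWithFalse (suc m) = begin
    sumForestWeights (vecsWithFalse (suc m))  ≈⟨ sumForestWeights-split (allVecs m) (vecsWithFalse m) ⟩
    a * sumForestWeights (allVecs m) + b * sumForestWeights (vecsWithFalse m)
      ≈⟨ +-cong (*-congˡ (sumForestWeights-allVecs m)) (*-congˡ (sumForestWeights-vecsWithFalse m)) ⟩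
    a * X + b * (X - Y)                       ≈⟨ +-congˡ (x[y-z]≈xy-xz b X Y) ⟩
    a * X + (b * X - b * Y)                   ≈⟨ +-assoc _ _ _ ⟨
    (a * X + b * X) - b * Y                   ≈⟨ +-congʳ (distribʳ X a b) ⟨
    (a + b) * X - b * Y                       ∎
    where
    X = pow (a + b) m
    Y = pow b m

theorem3p9 : ∀ {c ℓ : Level} (R : CommutativeRing c ℓ) (n : ℕ) .{{_ : NonZero n}}
               (a b : CommutativeRing.Carrier R) →
               let open CommutativeRing R
                   open Weights R
               in Σ (List (Subgraph n)) EnumeratesORSF
                  × (∀ (L : List (Subgraph n)) → EnumeratesORSF L →
                       sumWeights a b L ≈ pow (a + b) n - pow b n)
theorem3p9 R (suc n) a b = (forests , forests-enumerate) , λ L enumerates → begin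
  sumWeights a b L                               ≈⟨ sumWeights-↭ (enumerations-↭ enumerates (forests-enumerate {n})) ⟩
  sumWeights a b (forests {n})                   ≈⟨ sumWeights-forests (vecsWithFalse (suc n)) ⟩
  sumForestWeights (vecsWithFalse (suc n))       ≈⟨ sumForestWeights-vecsWithFalse (suc n) ⟩
  pow (a + b) (suc n) - pow b (suc n)            ∎
  where
  open CommutativeRing R using (setoid; _+_; _-_)
  open Weights R
  open WeightedSums R a b
  open import Relation.Binary.Reasoning.Setoid setoid
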